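{- Let $z:[n]\to[k]$ be any map and $q,q'\in[k]$. Define $z_q^{q'}:[n]\to[k]$ by $z_q^{q'}(i)=q$ if $z(i)=q'$ and $z_q^{q'}(i)=z(i)$ otherwise. Then $\ker_{\mathbb Z}A_{n,z}\subseteq\ker_{\mathbb Z}A_{n,z_q^{q'}}$.
   Context: For a map $y:[n]\to[k]$, $A_{n,y}$ is the matrix obtained by stacking the $n\times\binom n2$ vertex-edge incidence matrix of $K_n$ on top of the $\binom{k+1}2\times\binom n2$ matrix whose rows are indexed by pairs $(i,j)$, $1\le i\le j\le k$, and whose column $\{u,v\}$ has a single $1$ in row $(\min(y(u),y(v)),\max(y(u),y(v)))$ and zeros elsewhere. -}

module Defs where

open import Data.Nat using (ℕ; zero; suc)
open import Data.Fin using (Fin; zero; suc; _<_; _≤_; _≟_; _<?_; _≤?_)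
open import Data.Integer using (ℤ; _+_; _*_; 0ℤ; 1ℤ)
open import Data.Product using (Σ; _×_; _,_; proj₁; proj₂)
open import Data.Sum using (_⊎_; inj₁; inj₂)
open import Data.Bool using (Bool; true; false; _∨_; _∧_; if_then_else_)
open import Relation.Nullary.Decidable using (⌊_⌋)
open import Relation.Binary.PropositionalEquality using (_≡_)

sumFin : ∀ {n} → (Fin n → ℤ) → ℤ
sumFin {zero}  f = 0ℤ
sumFin {suc n} f = f zero + sumFin (λ i → f (suc i))

-- Edges of K_n (vertices [n] = Fin n): pairs {u,v} written as u < v.
Edge : ℕ → Set
Edge n = Σ (Fin n × Fin n) (λ p → proj₁ p < proj₂ p)

sumEdges : ∀ {n} → (Edge n → ℤ) → ℤ
sumEdges {n} f = sumFin (λ u → sumFin (λ v → g u v (u <? v)))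
  where
  open import Relation.Nullary using (Dec; yes; no)
  g : (u v : Fin n) → Dec (u < v) → ℤ
  g u v (yes u<v) = f ((u , v) , u<v)
  g u v (no _)    = 0ℤ

-- Rows of A_{n,y}: vertices w ∈ [n], then pairs (i,j) with 1 ≤ i ≤ j ≤ k.
Row : ℕ → ℕ → Set
Row n k = Fin n ⊎ Σ (Fin k × Fin k) (λ p → proj₁ p ≤ proj₂ p)

minF maxF : ∀ {k} → Fin k → Fin k → Fin k
minF a b = if ⌊ a ≤? b ⌋ then a else b
maxF a b = if ⌊ a ≤? b ⌋ then b else a

indicator : Bool → ℤ
indicator true  = 1ℤ
indicator false = 0ℤ

-- The matrix A_{n,y}: incidence matrix of K_n stacked on the class matrix.
A : ∀ {n k} → (Fin n → Fin k) → Row n k → Edge n → ℤ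
A y (inj₁ w) ((u , v) , _) = indicator (⌊ w ≟ u ⌋ ∨ ⌊ w ≟ v ⌋)
A y (inj₂ ((i , j) , _)) ((u , v) , _) =
  indicator (⌊ minF (y u) (y v) ≟ i ⌋ ∧ ⌊ maxF (y u) (y v) ≟ j ⌋)

InKerℤ : ∀ {n k} → (Fin n → Fin k) → (Edge n → ℤ) → Set
InKerℤ {n} {k} y x = ∀ (r : Row n k) → sumEdges (λ e → A y r e * x e) ≡ 0ℤ

replace : ∀ {n k} → (Fin n → Fin k) → Fin k → Fin k → Fin n → Fin k
replace z q q' i = if ⌊ z i ≟ q' ⌋ then q else z i

{-# OPTIONS --safe #-}
-- Write z_q^{q'} = f ∘ z, where f collapses the colour q' onto q. For any recolouring
-- f : [k] → [l] the vertex rows of A_{n,f∘z} and A_{n,z} coincide, and the class row (i,j)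
-- of A_{n,f∘z} is the sum of the class rows (a,b) of A_{n,z} over the pairs a ≤ b with
-- {f a, f b} = {i, j}: an edge lies in class (i,j) after recolouring exactly when its class
-- (a,b) before recolouring is such a pair. Hence A_{n,f∘z} x = 0 whenever A_{n,z} x = 0.
module Submission where

open import Defs
open import Data.Nat using (ℕ; zero; suc)
open import Data.Nat.Properties using (≰⇒≥)
open import Data.Fin using (Fin; zero; suc; _≤_; _<_; _≟_; _≤?_; _<?_)
open import Data.Fin.Properties using (≤-antisym)
open import Data.Integer using (ℤ; _+_; _*_; 0ℤ; 1ℤ)
open import Data.Integer.Properties
  using (+-*-semiring; +-identityˡ; +-identityʳ; *-identityˡ; *-identityʳ; *-zeroʳ; *-assoc; *-comm)
open import Algebra.Properties.Semiring.Sum +-*-semiring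
  using (sum; sum-syntax; sum-cong-≗; sum-replicate-zero; ∑-comm; *-distribˡ-sum; *-distribʳ-sum)
open import Data.Product using (_,_; proj₁; proj₂)
open import Data.Sum using (inj₁; inj₂)
open import Data.Bool using (true; false; _∧_)
open import Function using (_∘_; id)
open import Relation.Nullary using (Dec; yes; no; ¬_; contradiction)
open import Relation.Nullary.Decidable using (⌊_⌋; ⌊⌋-map′)
open import Relation.Binary.PropositionalEquality using (_≡_; refl; sym; trans; cong; cong₂; module ≡-Reasoning)
open ≡-Reasoning

∑-zero : ∀ {n} {f : Fin n → ℤ} → (∀ i → f i ≡ 0ℤ) → ∑[ i < n ] f i ≡ 0ℤ
∑-zero {n} f≗0 = trans (sum-cong-≗ f≗0) (sum-replicate-zero n)

sumFin≡sum : ∀ {n} (f : Fin n → ℤ) → sumFin f ≡ sum f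
sumFin≡sum {zero}  f = refl
sumFin≡sum {suc n} f = cong (f zero +_) (sumFin≡sum (f ∘ suc))

sumFin²≡∑² : ∀ {n} {t t′ : Fin n → Fin n → ℤ} → (∀ u v → t u v ≡ t′ u v) →
  sumFin (λ u → sumFin (t u)) ≡ ∑[ u < n ] ∑[ v < n ] t′ u v
sumFin²≡∑² {t = t} t≗t′ = trans (sumFin≡sum (λ u → sumFin (t u)))
  (sum-cong-≗ λ u → trans (sumFin≡sum (t u)) (sum-cong-≗ (t≗t′ u)))

∑-indicator-≟ : ∀ {k} (a : Fin k) (g : Fin k → ℤ) → ∑[ b < k ] (g b * indicator ⌊ a ≟ b ⌋) ≡ g a
∑-indicator-≟ {suc k} zero g = begin
  g zero * 1ℤ + ∑[ b < k ] (g (suc b) * 0ℤ)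
    ≡⟨ cong₂ _+_ (*-identityʳ (g zero)) (∑-zero (*-zeroʳ ∘ g ∘ suc)) ⟩
  g zero + 0ℤ
    ≡⟨ +-identityʳ (g zero) ⟩
  g zero
    ∎
∑-indicator-≟ {suc k} (suc a) g = begin
  g zero * 0ℤ + ∑[ b < k ] (g (suc b) * indicator ⌊ suc a ≟ suc b ⌋)
    ≡⟨ cong (g zero * 0ℤ +_) (sum-cong-≗ λ b → cong (λ t → g (suc b) * indicator t) (⌊⌋-map′ _ _ (a ≟ b))) ⟩
  g zero * 0ℤ + ∑[ b < k ] (g (suc b) * indicator ⌊ a ≟ b ⌋)
    ≡⟨ cong₂ _+_ (*-zeroʳ (g zero)) (∑-indicator-≟ a (g ∘ suc)) ⟩
  0ℤ + g (suc a)
    ≡⟨ +-identityˡ (g (suc a)) ⟩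
  g (suc a)
    ∎

module _ {k : ℕ} where

  minF-comm : (a b : Fin k) → minF a b ≡ minF b a
  minF-comm a b with a ≤? b | b ≤? a
  ... | yes a≤b | yes b≤a = ≤-antisym a≤b b≤a
  ... | yes _   | no _    = refl
  ... | no _    | yes _   = refl
  ... | no a≰b  | no b≰a  = contradiction (≰⇒≥ a≰b) b≰a

  maxF-comm : (a b : Fin k) → maxF a b ≡ maxF b a
  maxF-comm a b with a ≤? b | b ≤? a
  ... | yes a≤b | yes b≤a = ≤-antisym b≤a a≤b
  ... | yes _   | no _    = refl
  ... | no _    | yes _   = refl
  ... | no a≰b  | no b≰a  = contradiction (≰⇒≥ a≰b) b≰a

  minF≤maxF : (a b : Fin k) → minF a b ≤ maxF a b
  minF≤maxF a b with a ≤? b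
  ... | yes a≤b = a≤b
  ... | no a≰b  = ≰⇒≥ a≰b

indicator-∧ : ∀ p q → indicator (p ∧ q) ≡ indicator p * indicator q
indicator-∧ true  q = sym (*-identityˡ (indicator q))
indicator-∧ false q = refl

-- The entry of row (i , j) of the lower block of A_{n,y} in column {u , v}; it is also
-- defined for i > j, where it vanishes (classEntry-≰).
classEntry : ∀ {m k} → (Fin m → Fin k) → Fin k → Fin k → Fin m → Fin m → ℤ
classEntry y i j u v = indicator (⌊ minF (y u) (y v) ≟ i ⌋ ∧ ⌊ maxF (y u) (y v) ≟ j ⌋)

module _ {m k : ℕ} (y : Fin m → Fin k) (i j : Fin k) where

  classEntry-sym : (u v : Fin m) → classEntry y i j u v ≡ classEntry y i j v u
  classEntry-sym u v rewrite minF-comm (y u) (y v) | maxF-comm (y u) (y v) = refl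

  classEntry-minF-maxF : (u v : Fin m) → classEntry y i j (minF u v) (maxF u v) ≡ classEntry y i j u v
  classEntry-minF-maxF u v with u ≤? v
  ... | yes _ = refl
  ... | no _  = classEntry-sym v u

  classEntry-≰ : ¬ i ≤ j → (u v : Fin m) → classEntry y i j u v ≡ 0ℤ
  classEntry-≰ i≰j u v with minF (y u) (y v) ≟ i | maxF (y u) (y v) ≟ j | minF≤maxF (y u) (y v)
  ... | yes refl | yes refl | i≤j = contradiction i≤j i≰j
  ... | yes _    | no _     | _   = refl
  ... | no _     | _        | _   = refl

classEntry-fibres : ∀ {m k} (y : Fin m → Fin k) (h : Fin k → Fin k → ℤ) (u v : Fin m) →
  ∑[ a < k ] ∑[ b < k ] (h a b * classEntry y a b u v) ≡ h (minF (y u) (y v)) (maxF (y u) (y v))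
classEntry-fibres {k = k} y h u v = begin
  ∑[ a < k ] ∑[ b < k ] (h a b * classEntry y a b u v)
    ≡⟨ sum-cong-≗ (λ a → sum-cong-≗ (λ b → split (h a b) ⌊ lo ≟ a ⌋ ⌊ hi ≟ b ⌋)) ⟩
  ∑[ a < k ] ∑[ b < k ] (h a b * indicator ⌊ hi ≟ b ⌋ * indicator ⌊ lo ≟ a ⌋)
    ≡⟨ sum-cong-≗ (λ a → sym (*-distribʳ-sum (indicator ⌊ lo ≟ a ⌋) (λ b → h a b * indicator ⌊ hi ≟ b ⌋))) ⟩
  ∑[ a < k ] (∑[ b < k ] (h a b * indicator ⌊ hi ≟ b ⌋) * indicator ⌊ lo ≟ a ⌋)
    ≡⟨ sum-cong-≗ (λ a → cong (_* indicator ⌊ lo ≟ a ⌋) (∑-indicator-≟ hi (h a))) ⟩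
  ∑[ a < k ] (h a hi * indicator ⌊ lo ≟ a ⌋)
    ≡⟨ ∑-indicator-≟ lo (λ a → h a hi) ⟩
  h lo hi
    ∎
  where
  lo = minF (y u) (y v)
  hi = maxF (y u) (y v)
  split : ∀ c p q → c * indicator (p ∧ q) ≡ c * indicator q * indicator p
  split c p q = begin
    c * indicator (p ∧ q)             ≡⟨ cong (c *_) (trans (indicator-∧ p q) (*-comm (indicator p) (indicator q))) ⟩
    c * (indicator q * indicator p)   ≡⟨ sym (*-assoc c (indicator q) (indicator p)) ⟩
    c * indicator q * indicator p     ∎

⟨_,_⟩ : ∀ {n} → (Fin n → Fin n → ℤ) → (Fin n → Fin n → ℤ) → ℤ
⟨_,_⟩ {n} Y X = ∑[ u < n ] ∑[ v < n ] (Y u v * X u v)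

module _ {n : ℕ} (X : Fin n → Fin n → ℤ) where

  ⟨⟩-congˡ : ∀ {Y Y′} → (∀ u v → Y u v ≡ Y′ u v) → ⟨ Y , X ⟩ ≡ ⟨ Y′ , X ⟩
  ⟨⟩-congˡ Y≗Y′ = sum-cong-≗ λ u → sum-cong-≗ λ v → cong (_* X u v) (Y≗Y′ u v)

  ⟨⟩-sumˡ : ∀ {m} (Y : Fin m → Fin n → Fin n → ℤ) →
    ⟨ (λ u v → ∑[ a < m ] Y a u v) , X ⟩ ≡ ∑[ a < m ] ⟨ Y a , X ⟩
  ⟨⟩-sumˡ {m} Y = begin
    ∑[ u < n ] ∑[ v < n ] (∑[ a < m ] Y a u v * X u v)
      ≡⟨ sum-cong-≗ (λ u → sum-cong-≗ λ v → *-distribʳ-sum (X u v) (λ a → Y a u v)) ⟩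
    ∑[ u < n ] ∑[ v < n ] ∑[ a < m ] (Y a u v * X u v)
      ≡⟨ sum-cong-≗ (λ u → ∑-comm (λ v a → Y a u v * X u v)) ⟩
    ∑[ u < n ] ∑[ a < m ] ∑[ v < n ] (Y a u v * X u v)
      ≡⟨ ∑-comm (λ u a → ∑[ v < n ] (Y a u v * X u v)) ⟩
    ∑[ a < m ] ∑[ u < n ] ∑[ v < n ] (Y a u v * X u v)
      ∎

  ⟨⟩-scaleˡ : ∀ c (Y : Fin n → Fin n → ℤ) → ⟨ (λ u v → c * Y u v) , X ⟩ ≡ c * ⟨ Y , X ⟩
  ⟨⟩-scaleˡ c Y = begin
    ∑[ u < n ] ∑[ v < n ] (c * Y u v * X u v)
      ≡⟨ sum-cong-≗ (λ u → sum-cong-≗ λ v → *-assoc c (Y u v) (X u v)) ⟩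
    ∑[ u < n ] ∑[ v < n ] (c * (Y u v * X u v))
      ≡⟨ sum-cong-≗ (λ u → sym (*-distribˡ-sum c (λ v → Y u v * X u v))) ⟩
    ∑[ u < n ] (c * ∑[ v < n ] (Y u v * X u v))
      ≡⟨ sym (*-distribˡ-sum c (λ u → ∑[ v < n ] (Y u v * X u v))) ⟩
    c * ⟨ Y , X ⟩
      ∎

onPair : ∀ {n} → (Edge n → ℤ) → (u v : Fin n) → Dec (u < v) → ℤ
onPair x u v (yes u<v) = x ((u , v) , u<v)
onPair x u v (no _)    = 0ℤ

extendByZero : ∀ {n} → (Edge n → ℤ) → Fin n → Fin n → ℤ
extendByZero x u v = onPair x u v (u <? v)

mutual
  sumEdges-weighted : ∀ {n} (φ : Fin n → Fin n → ℤ) (x : Edge n → ℤ) →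
    sumEdges (λ e → φ (proj₁ (proj₁ e)) (proj₂ (proj₁ e)) * x e) ≡ ⟨ φ , extendByZero x ⟩
  sumEdges-weighted φ x = sumFin²≡∑² (sumEdges-summand φ x)

  -- The left-hand side is the summand of sumEdges, which uses a helper local to the
  -- definition of sumEdges and so cannot be named; it is inferred from sumEdges-weighted.
  sumEdges-summand : ∀ {n} (φ : Fin n → Fin n → ℤ) (x : Edge n → ℤ) (u v : Fin n) →
    _ ≡ φ u v * onPair x u v (u <? v)
  sumEdges-summand φ x u v with u <? v
  ... | yes _ = refl
  ... | no _  = sym (*-zeroʳ (φ u v))

InKerℤ⇒classSums≡0 : ∀ {n k} {y : Fin n → Fin k} {x : Edge n → ℤ} → InKerℤ y x →
  ∀ i j → ⟨ classEntry y i j , extendByZero x ⟩ ≡ 0ℤ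
InKerℤ⇒classSums≡0 {y = y} {x} y·x≡0 i j with i ≤? j
... | yes i≤j = trans (sym (sumEdges-weighted (classEntry y i j) x)) (y·x≡0 (inj₂ ((i , j) , i≤j)))
... | no i≰j  = ∑-zero λ u → ∑-zero λ v → cong (_* extendByZero x u v) (classEntry-≰ y i j i≰j u v)

InKerℤ-∘ : ∀ {n k l} (f : Fin k → Fin l) {z : Fin n → Fin k} {x : Edge n → ℤ} →
  InKerℤ z x → InKerℤ (f ∘ z) x
InKerℤ-∘ f z·x≡0 (inj₁ w) = z·x≡0 (inj₁ w)
InKerℤ-∘ {n} {k} f {z} {x} z·x≡0 (inj₂ ((i , j) , _)) = begin
  sumEdges (λ e → classEntry (f ∘ z) i j (proj₁ (proj₁ e)) (proj₂ (proj₁ e)) * x e)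
    ≡⟨ sumEdges-weighted (classEntry (f ∘ z) i j) x ⟩
  ⟨ classEntry (f ∘ z) i j , X ⟩
    ≡⟨ ⟨⟩-congˡ X (λ u v → sym (pushforward u v)) ⟩
  ⟨ (λ u v → ∑[ a < k ] ∑[ b < k ] (c a b * classEntry z a b u v)) , X ⟩
    ≡⟨ ⟨⟩-sumˡ X (λ a u v → ∑[ b < k ] (c a b * classEntry z a b u v)) ⟩
  ∑[ a < k ] ⟨ (λ u v → ∑[ b < k ] (c a b * classEntry z a b u v)) , X ⟩
    ≡⟨ sum-cong-≗ (λ a → ⟨⟩-sumˡ X (λ b u v → c a b * classEntry z a b u v)) ⟩
  ∑[ a < k ] ∑[ b < k ] ⟨ (λ u v → c a b * classEntry z a b u v) , X ⟩
    ≡⟨ sum-cong-≗ (λ a → sum-cong-≗ λ b → ⟨⟩-scaleˡ X (c a b) (classEntry z a b)) ⟩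
  ∑[ a < k ] ∑[ b < k ] (c a b * ⟨ classEntry z a b , X ⟩)
    ≡⟨ ∑-zero (λ a → ∑-zero λ b → trans (cong (c a b *_) (InKerℤ⇒classSums≡0 z·x≡0 a b)) (*-zeroʳ (c a b))) ⟩
  0ℤ
    ∎
  where
  X : Fin n → Fin n → ℤ
  X = extendByZero x
  c : Fin k → Fin k → ℤ
  c = classEntry f i j
  pushforward : ∀ u v → ∑[ a < k ] ∑[ b < k ] (c a b * classEntry z a b u v) ≡ classEntry (f ∘ z) i j u v
  pushforward u v = trans (classEntry-fibres z c u v) (classEntry-minF-maxF f i j (z u) (z v))

-- replace z q q' is definitionally replace id q q' ∘ z.
lemma4p3 : (n k : ℕ) (z : Fin n → Fin k) (q q' : Fin k) (x : Edge n → ℤ)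
    → InKerℤ z x → InKerℤ (replace z q q') x
lemma4p3 n k z q q' x = InKerℤ-∘ (replace id q q')
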